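{- System $\mathsf{F}_{<:}^{K\top}$ is not a conservative extension of System $\mathsf{F}_{<:}^{\top}$: there exist an $\mathsf{F}_{<:}^{\top}$-term $\Theta\vdash^\top t$ and an $\mathsf{F}_{<:}^{\top}$-type $\Theta\vdash^\top T$ such that $\Theta\vdash t:T$ is derivable in System $\mathsf{F}_{<:}^{K\top}$ but $\Theta\vdash^\top t:T$ is not derivable in System $\mathsf{F}_{<:}^{\top}$.
   Context: System $\mathsf{F}_{<:}^{K\top}$. Raw types: $T ::= \top \mid X \mid T\to T \mid \forall^{K}(X<:T).T \mid \forall^{\top}(X<:T).T$ (up to $\alpha$-conversion). Raw terms: $t ::= \mathsf{top}\mid x\mid \lambda(x:T).t\mid \Lambda(X<:T).t\mid t\,t\mid t\{T\}$. Contexts are finite sequences of $X<:T$ and $x:T$ with the usual well-formedness judgments. Subtyping $\Theta\vdash S<:T$: (Var) $\Theta,X<:T,\Theta'\vdash X<:T$; (Top); (Refl); (Trans); ($\to$) contravariant in domain, covariant in codomain; ($\forall$-Fun) from $\Theta,X<:S\vdash T<:T'$ infer $\Theta\vdash\forall^K(X<:S).T<:\forall^K(X<:S).T'$; ($\forall$-Loc) from $\Theta\vdash T_0<:S_0$ and $\Theta,X<:S_0\vdash S_1<:T_1$ infer $\Theta\vdash\forall^K(X<:S_0).S_1<:\forall^\top(X<:T_0).T_1$; ($\forall$-Top) from $\Theta\vdash T_0<:S_0$ and $\Theta,X<:\top\vdash S_1<:T_1$ infer $\Theta\vdash\forall^\top(X<:S_0).S_1<:\forall^\top(X<:T_0).T_1$.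 Typing: $\mathsf{top}:\top$; variables; subsumption; $\lambda$-intro; application; from $\Theta,X<:S\vdash t:T$ infer $\Theta\vdash\Lambda(X<:S).t:\forall^K(X<:S).T$; from $\Theta\vdash t:\forall^\top(X<:S).T$ and $\Theta\vdash S'<:S$ infer $\Theta\vdash t\{S'\}:T[S'/X]$. $\mathsf{F}_{<:}^{\top}$-types are the types with no $\forall^K$; an $\mathsf{F}_{<:}^{\top}$-term has all type annotations (in its context and in the term) being $\mathsf{F}_{<:}^{\top}$-types; $\Theta\vdash^\top T$ means all types involved are $\mathsf{F}_{<:}^{\top}$-types. System $\mathsf{F}_{<:}^{\top}$ uses only $\mathsf{F}_{<:}^{\top}$-types, subtyping rules Var, Top, Refl, Trans, $\to$, $\forall$-Top, and the same typing rules except that $\Lambda$-introduction yields $\Theta\vdash\Lambda(X<:S).t:\forall^\top(X<:S).T$; $\Theta\vdash^\top t:T$ denotes derivability in System $\mathsf{F}_{<:}^{\top}$. -}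

module Defs where

open import Data.Bool using (Bool; true; false)
open import Data.Nat using (ℕ; zero; suc)
open import Data.Fin using (Fin; zero; suc)
open import Data.Product using (Σ; _×_; _,_)
open import Relation.Nullary using (¬_)

-- Types, indexed by a mode flag k and the number n of type variables in scope
-- (de Bruijn indices).  k = true : types of System F<:^{K⊤};
-- k = false : exactly the F<:^⊤-types (no ∀^K).
data Ty : Bool → ℕ → Set where
  ⊤    : ∀ {k n} → Ty k n
  var  : ∀ {k n} → Fin n → Ty k n
  _⇒_  : ∀ {k n} → Ty k n → Ty k n → Ty k n
  ∀K   : ∀ {n} → Ty true n → Ty true (suc n) → Ty true n
  ∀T   : ∀ {k n} → Ty k n → Ty k (suc n) → Ty k n

infixr 7 _⇒_

ext : ∀ {n m} → (Fin n → Fin m) → Fin (suc n) → Fin (suc m)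
ext ρ zero    = zero
ext ρ (suc i) = suc (ρ i)

ren : ∀ {k n m} → (Fin n → Fin m) → Ty k n → Ty k m
ren ρ ⊤         = ⊤
ren ρ (var i)   = var (ρ i)
ren ρ (S ⇒ T)   = ren ρ S ⇒ ren ρ T
ren ρ (∀K S T)  = ∀K (ren ρ S) (ren (ext ρ) T)
ren ρ (∀T S T)  = ∀T (ren ρ S) (ren (ext ρ) T)

wk : ∀ {k n} → Ty k n → Ty k (suc n)
wk = ren suc

exts : ∀ {k n m} → (Fin n → Ty k m) → Fin (suc n) → Ty k (suc m)
exts σ zero    = var zero
exts σ (suc i) = wk (σ i)

sub : ∀ {k n m} → (Fin n → Ty k m) → Ty k n → Ty k m
sub σ ⊤         = ⊤
sub σ (var i)   = σ i
sub σ (S ⇒ T)   = sub σ S ⇒ sub σ T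
sub σ (∀K S T)  = ∀K (sub σ S) (sub (exts σ) T)
sub σ (∀T S T)  = ∀T (sub σ S) (sub (exts σ) T)

sub0 : ∀ {k n} → Ty k n → Fin (suc n) → Ty k n
sub0 S zero    = S
sub0 S (suc i) = var i

_[_] : ∀ {k n} → Ty k (suc n) → Ty k n → Ty k n
T [ S ] = sub (sub0 S) T

data Ctx (k : Bool) : ℕ → Set where
  ∅     : Ctx k zero
  _,<:_ : ∀ {n} → Ctx k n → Ty k n → Ctx k (suc n)
  _,∶_  : ∀ {n} → Ctx k n → Ty k n → Ctx k n

-- Raw terms; term variables are de Bruijn indices counting term bindings only.
data Tm : Bool → ℕ → Set where
  top  : ∀ {k n} → Tm k n
  ‵_   : ∀ {k n} → ℕ → Tm k n
  ƛ    : ∀ {k n} → Ty k n → Tm k n → Tm k n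
  Λ    : ∀ {k n} → Ty k n → Tm k (suc n) → Tm k n
  _·_  : ∀ {k n} → Tm k n → Tm k n → Tm k n
  _⟪_⟫ : ∀ {k n} → Tm k n → Ty k n → Tm k n

data _∋_<:_ {k} : ∀ {n} → Ctx k n → Fin n → Ty k n → Set where
  here  : ∀ {n} {Γ : Ctx k n} {T} → (Γ ,<: T) ∋ zero <: wk T
  there : ∀ {n} {Γ : Ctx k n} {X T S} → Γ ∋ X <: T → (Γ ,<: S) ∋ suc X <: wk T
  skip  : ∀ {n} {Γ : Ctx k n} {X T S} → Γ ∋ X <: T → (Γ ,∶ S) ∋ X <: T

data _∋_∶_ {k} : ∀ {n} → Ctx k n → ℕ → Ty k n → Set where
  here  : ∀ {n} {Γ : Ctx k n} {T} → (Γ ,∶ T) ∋ zero ∶ T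
  there : ∀ {n} {Γ : Ctx k n} {x T S} → Γ ∋ x ∶ T → (Γ ,∶ S) ∋ suc x ∶ T
  skip  : ∀ {n} {Γ : Ctx k n} {x T S} → Γ ∋ x ∶ T → (Γ ,<: S) ∋ x ∶ wk T

data _⊢K_<:_ : ∀ {n} → Ctx true n → Ty true n → Ty true n → Set where
  s-var   : ∀ {n} {Γ : Ctx true n} {X T} → Γ ∋ X <: T → Γ ⊢K var X <: T
  s-top   : ∀ {n} {Γ : Ctx true n} {S} → Γ ⊢K S <: ⊤
  s-refl  : ∀ {n} {Γ : Ctx true n} {S} → Γ ⊢K S <: S
  s-trans : ∀ {n} {Γ : Ctx true n} {S U T} → Γ ⊢K S <: U → Γ ⊢K U <: T → Γ ⊢K S <: T
  s-arr   : ∀ {n} {Γ : Ctx true n} {S₁ S₂ T₁ T₂} →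
            Γ ⊢K T₁ <: S₁ → Γ ⊢K S₂ <: T₂ → Γ ⊢K (S₁ ⇒ S₂) <: (T₁ ⇒ T₂)
  s-∀fun  : ∀ {n} {Γ : Ctx true n} {S T T′} →
            (Γ ,<: S) ⊢K T <: T′ → Γ ⊢K ∀K S T <: ∀K S T′
  s-∀loc  : ∀ {n} {Γ : Ctx true n} {S₀ S₁ T₀ T₁} →
            Γ ⊢K T₀ <: S₀ → (Γ ,<: S₀) ⊢K S₁ <: T₁ → Γ ⊢K ∀K S₀ S₁ <: ∀T T₀ T₁
  s-∀top  : ∀ {n} {Γ : Ctx true n} {S₀ S₁ T₀ T₁} →
            Γ ⊢K T₀ <: S₀ → (Γ ,<: ⊤) ⊢K S₁ <: T₁ → Γ ⊢K ∀T S₀ S₁ <: ∀T T₀ T₁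

data _⊢K_∶_ : ∀ {n} → Ctx true n → Tm true n → Ty true n → Set where
  t-top  : ∀ {n} {Γ : Ctx true n} → Γ ⊢K top ∶ ⊤
  t-var  : ∀ {n} {Γ : Ctx true n} {x T} → Γ ∋ x ∶ T → Γ ⊢K (‵ x) ∶ T
  t-sub  : ∀ {n} {Γ : Ctx true n} {t S T} → Γ ⊢K t ∶ S → Γ ⊢K S <: T → Γ ⊢K t ∶ T
  t-abs  : ∀ {n} {Γ : Ctx true n} {t S T} → (Γ ,∶ S) ⊢K t ∶ T → Γ ⊢K ƛ S t ∶ (S ⇒ T)
  t-app  : ∀ {n} {Γ : Ctx true n} {t u S T} → Γ ⊢K t ∶ (S ⇒ T) → Γ ⊢K u ∶ S → Γ ⊢K (t · u) ∶ T
  t-tabs : ∀ {n} {Γ : Ctx true n} {t S T} → (Γ ,<: S) ⊢K t ∶ T → Γ ⊢K Λ S t ∶ ∀K S T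
  t-tapp : ∀ {n} {Γ : Ctx true n} {t S S′ T} →
           Γ ⊢K t ∶ ∀T S T → Γ ⊢K S′ <: S → Γ ⊢K (t ⟪ S′ ⟫) ∶ (T [ S′ ])

data _⊢⊤_<:_ : ∀ {n} → Ctx false n → Ty false n → Ty false n → Set where
  s-var   : ∀ {n} {Γ : Ctx false n} {X T} → Γ ∋ X <: T → Γ ⊢⊤ var X <: T
  s-top   : ∀ {n} {Γ : Ctx false n} {S} → Γ ⊢⊤ S <: ⊤
  s-refl  : ∀ {n} {Γ : Ctx false n} {S} → Γ ⊢⊤ S <: S
  s-trans : ∀ {n} {Γ : Ctx false n} {S U T} → Γ ⊢⊤ S <: U → Γ ⊢⊤ U <: T → Γ ⊢⊤ S <: T
  s-arr   : ∀ {n} {Γ : Ctx false n} {S₁ S₂ T₁ T₂} →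
            Γ ⊢⊤ T₁ <: S₁ → Γ ⊢⊤ S₂ <: T₂ → Γ ⊢⊤ (S₁ ⇒ S₂) <: (T₁ ⇒ T₂)
  s-∀top  : ∀ {n} {Γ : Ctx false n} {S₀ S₁ T₀ T₁} →
            Γ ⊢⊤ T₀ <: S₀ → (Γ ,<: ⊤) ⊢⊤ S₁ <: T₁ → Γ ⊢⊤ ∀T S₀ S₁ <: ∀T T₀ T₁

data _⊢⊤_∶_ : ∀ {n} → Ctx false n → Tm false n → Ty false n → Set where
  t-top  : ∀ {n} {Γ : Ctx false n} → Γ ⊢⊤ top ∶ ⊤
  t-var  : ∀ {n} {Γ : Ctx false n} {x T} → Γ ∋ x ∶ T → Γ ⊢⊤ (‵ x) ∶ T
  t-sub  : ∀ {n} {Γ : Ctx false n} {t S T} → Γ ⊢⊤ t ∶ S → Γ ⊢⊤ S <: T → Γ ⊢⊤ t ∶ T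
  t-abs  : ∀ {n} {Γ : Ctx false n} {t S T} → (Γ ,∶ S) ⊢⊤ t ∶ T → Γ ⊢⊤ ƛ S t ∶ (S ⇒ T)
  t-app  : ∀ {n} {Γ : Ctx false n} {t u S T} → Γ ⊢⊤ t ∶ (S ⇒ T) → Γ ⊢⊤ u ∶ S → Γ ⊢⊤ (t · u) ∶ T
  t-tabs : ∀ {n} {Γ : Ctx false n} {t S T} → (Γ ,<: S) ⊢⊤ t ∶ T → Γ ⊢⊤ Λ S t ∶ ∀T S T
  t-tapp : ∀ {n} {Γ : Ctx false n} {t S S′ T} →
           Γ ⊢⊤ t ∶ ∀T S T → Γ ⊢⊤ S′ <: S → Γ ⊢⊤ (t ⟪ S′ ⟫) ∶ (T [ S′ ])

embTy : ∀ {k n} → Ty k n → Ty true n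
embTy ⊤        = ⊤
embTy (var i)  = var i
embTy (S ⇒ T)  = embTy S ⇒ embTy T
embTy (∀K S T) = ∀K (embTy S) (embTy T)
embTy (∀T S T) = ∀T (embTy S) (embTy T)

embCtx : ∀ {k n} → Ctx k n → Ctx true n
embCtx ∅         = ∅
embCtx (Γ ,<: T) = embCtx Γ ,<: embTy T
embCtx (Γ ,∶ T)  = embCtx Γ ,∶ embTy T

embTm : ∀ {k n} → Tm k n → Tm true n
embTm top        = top
embTm (‵ x)      = ‵ x
embTm (ƛ S t)    = ƛ (embTy S) (embTm t)
embTm (Λ S t)    = Λ (embTy S) (embTm t)
embTm (t · u)    = embTm t · embTm u
embTm (t ⟪ S ⟫)  = embTm t ⟪ embTy S ⟫

module Submission where

-- The term is (Λ(X<:⊤). Λ(Y<:⊤→X). λ(x:X). top){⊤→⊤} and the type ∀^⊤(Y<:⊤→⊤→⊤). Y→⊤.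
-- In F<:^{K⊤} the inner abstraction has a ∀^K type, and ∀-Loc lets us weaken it to a ∀^⊤
-- type while keeping the bound of Y, so Y <: ⊤→⊤ and the body (⊤→⊤)→⊤ is a subtype of Y→⊤.
-- In F<:^⊤ every type of a Λ is ⊤ or a ∀^⊤, and comparing two of them forgets the bound of Y
-- (rule ∀-Top). Inverting a putative derivation shows the body must have type X→D, hence
-- (⊤→⊤)→D after instantiation, which would need Y <: ⊤→⊤ under the bound Y <: ⊤.

open import Defs
open import Data.Bool using (false)
open import Data.Nat using (ℕ)
open import Data.Fin using (Fin; zero; suc)
open import Data.Product using (Σ; _×_; _,_)
open import Data.Sum using (_⊎_; inj₁; inj₂)
open import Relation.Nullary using (¬_)
open import Relation.Binary.PropositionalEquality using (_≡_; refl)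

private
  variable
    n : ℕ
    Γ Δ : Ctx false n
    A B C S U : Ty false n
    X : Fin n

bound : ∀ {k} (Γ : Ctx k n) (X : Fin n) → Σ (Ty k n) (λ B → Γ ∋ X <: B)
bound (Γ ,<: S) zero    = wk S , here
bound (Γ ,<: S) (suc X) with bound Γ X
... | B , X<:B = wk B , there X<:B
bound (Γ ,∶ S)  X       with bound Γ X
... | B , X<:B = B , skip X<:B

⊤<:⇒≡⊤ : Γ ⊢⊤ ⊤ <: U → U ≡ ⊤
⊤<:⇒≡⊤ s-top         = refl
⊤<:⇒≡⊤ s-refl        = refl
⊤<:⇒≡⊤ (s-trans d e) with ⊤<:⇒≡⊤ d
... | refl = ⊤<:⇒≡⊤ e

⇒<:-inv : Γ ⊢⊤ (A ⇒ B) <: U →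
          U ≡ ⊤ ⊎ Σ (Ty false _) (λ C → Σ (Ty false _) (λ D →
                    U ≡ (C ⇒ D) × Γ ⊢⊤ C <: A × Γ ⊢⊤ B <: D))
⇒<:-inv s-top       = inj₁ refl
⇒<:-inv s-refl      = inj₂ (_ , _ , refl , s-refl , s-refl)
⇒<:-inv (s-arr d e) = inj₂ (_ , _ , refl , d , e)
⇒<:-inv (s-trans d e) with ⇒<:-inv d
... | inj₁ refl = inj₁ (⊤<:⇒≡⊤ e)
... | inj₂ (_ , _ , refl , C<:A , B<:D) with ⇒<:-inv e
...   | inj₁ refl = inj₁ refl
...   | inj₂ (_ , _ , refl , C′<:C , D<:D′) =
          inj₂ (_ , _ , refl , s-trans C′<:C C<:A , s-trans B<:D D<:D′)

∀<:-inv : ∀ {T} → Γ ⊢⊤ ∀T S T <: U →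
          U ≡ ⊤ ⊎ Σ (Ty false _) (λ S′ → Σ (Ty false _) (λ T′ →
                    U ≡ ∀T S′ T′ × (Γ ,<: ⊤) ⊢⊤ T <: T′))
∀<:-inv s-top        = inj₁ refl
∀<:-inv s-refl       = inj₂ (_ , _ , refl , s-refl)
∀<:-inv (s-∀top _ e) = inj₂ (_ , _ , refl , e)
∀<:-inv (s-trans d e) with ∀<:-inv d
... | inj₁ refl = inj₁ (⊤<:⇒≡⊤ e)
... | inj₂ (_ , _ , refl , T<:T′) with ∀<:-inv e
...   | inj₁ refl = inj₁ refl
...   | inj₂ (_ , _ , refl , T′<:T″) = inj₂ (_ , _ , refl , s-trans T<:T′ T′<:T″)

<:var⇒var : Γ ⊢⊤ C <: var X → Σ (Fin _) (λ Y → C ≡ var Y)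
<:var⇒var (s-var _)     = _ , refl
<:var⇒var s-refl        = _ , refl
<:var⇒var (s-trans d e) with <:var⇒var e
... | _ , refl = <:var⇒var d

var<:-inv : Γ ⊢⊤ var X <: U → U ≡ var X ⊎ Σ (Ty false _) (λ B → Γ ∋ X <: B × Γ ⊢⊤ B <: U)
var<:-inv         (s-var X<:B) = inj₂ (_ , X<:B , s-refl)
var<:-inv {Γ = Γ} {X = X} s-top with bound Γ X
... | B , X<:B = inj₂ (B , X<:B , s-top)
var<:-inv         s-refl       = inj₁ refl
var<:-inv         (s-trans d e) with var<:-inv d
... | inj₁ refl              = var<:-inv e
... | inj₂ (B , X<:B , B<:U) = inj₂ (B , X<:B , s-trans B<:U e)

var₀<:-inv : (Γ ,<: ⊤) ⊢⊤ var zero <: U → U ≡ var zero ⊎ U ≡ ⊤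
var₀<:-inv d with var<:-inv d
... | inj₁ U≡X            = inj₁ U≡X
... | inj₂ (_ , here , e) = inj₂ (⊤<:⇒≡⊤ e)

data _≼_ : Ctx false n → Ctx false n → Set where
  ∅      : ∅ ≼ ∅
  _,<:_  : Γ ≼ Δ → (S : Ty false n) → (Γ ,<: S) ≼ (Δ ,<: S)
  _,∶_   : Γ ≼ Δ → (S : Ty false n) → (Γ ,∶ S) ≼ (Δ ,∶ S)
  _,<:⊤_ : Γ ≼ Δ → (S : Ty false n) → (Γ ,<: S) ≼ (Δ ,<: ⊤)

≼-refl : Γ ≼ Γ
≼-refl {Γ = ∅}      = ∅
≼-refl {Γ = Γ ,<: S} = ≼-refl ,<: S
≼-refl {Γ = Γ ,∶ S}  = ≼-refl ,∶ S

≼-lookup : Γ ≼ Δ → Δ ∋ X <: B → Γ ∋ X <: B ⊎ B ≡ ⊤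
≼-lookup (_ ,<: _)  here        = inj₁ here
≼-lookup (_ ,<:⊤ _) here        = inj₂ refl
≼-lookup (Γ≼Δ ,<: _)  (there x) with ≼-lookup Γ≼Δ x
... | inj₁ y    = inj₁ (there y)
... | inj₂ refl = inj₂ refl
≼-lookup (Γ≼Δ ,<:⊤ _) (there x) with ≼-lookup Γ≼Δ x
... | inj₁ y    = inj₁ (there y)
... | inj₂ refl = inj₂ refl
≼-lookup (Γ≼Δ ,∶ _)   (skip x)  with ≼-lookup Γ≼Δ x
... | inj₁ y    = inj₁ (skip y)
... | inj₂ refl = inj₂ refl

narrow : Γ ≼ Δ → Δ ⊢⊤ A <: B → Γ ⊢⊤ A <: B
narrow Γ≼Δ (s-var x) with ≼-lookup Γ≼Δ x
... | inj₁ y    = s-var y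
... | inj₂ refl = s-top
narrow Γ≼Δ s-top         = s-top
narrow Γ≼Δ s-refl        = s-refl
narrow Γ≼Δ (s-trans d e) = s-trans (narrow Γ≼Δ d) (narrow Γ≼Δ e)
narrow Γ≼Δ (s-arr d e)   = s-arr (narrow Γ≼Δ d) (narrow Γ≼Δ e)
narrow Γ≼Δ (s-∀top d e)  = s-∀top (narrow Γ≼Δ d) (narrow (Γ≼Δ ,<: ⊤) e)

⟪⟫-inv : ∀ {t} → Γ ⊢⊤ (t ⟪ S ⟫) ∶ U →
         Σ (Ty false _) (λ S′ → Σ (Ty false _) (λ T → Γ ⊢⊤ t ∶ ∀T S′ T × Γ ⊢⊤ T [ S ] <: U))
⟪⟫-inv (t-tapp d _) = _ , _ , d , s-refl
⟪⟫-inv (t-sub d e) with ⟪⟫-inv d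
... | _ , _ , dt , T[S]<:U = _ , _ , dt , s-trans T[S]<:U e

Λ-inv : ∀ {b} → Γ ⊢⊤ Λ S b ∶ U →
        U ≡ ⊤ ⊎ Σ (Ty false _) (λ S′ → Σ (Ty false _) (λ T → U ≡ ∀T S′ T × (Γ ,<: S) ⊢⊤ b ∶ T))
Λ-inv (t-tabs d) = inj₂ (_ , _ , refl , d)
Λ-inv (t-sub d e) with Λ-inv d
... | inj₁ refl = inj₁ (⊤<:⇒≡⊤ e)
... | inj₂ (_ , _ , refl , db) with ∀<:-inv e
...   | inj₁ refl               = inj₁ refl
...   | inj₂ (_ , _ , refl , T<:T′) = inj₂ (_ , _ , refl , t-sub db (narrow (≼-refl ,<:⊤ _) T<:T′))

ƛ-inv : ∀ {b} → Γ ⊢⊤ ƛ A b ∶ U →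
        U ≡ ⊤ ⊎ Σ (Ty false _) (λ C → Σ (Ty false _) (λ D → U ≡ (C ⇒ D) × Γ ⊢⊤ C <: A))
ƛ-inv (t-abs _) = inj₂ (_ , _ , refl , s-refl)
ƛ-inv (t-sub d e) with ƛ-inv d
... | inj₁ refl = inj₁ (⊤<:⇒≡⊤ e)
... | inj₂ (_ , _ , refl , C<:A) with ⇒<:-inv e
...   | inj₁ refl                   = inj₁ refl
...   | inj₂ (_ , _ , refl , C′<:C , _) = inj₂ (_ , _ , refl , s-trans C′<:C C<:A)

poly : Tm false 0
poly = Λ ⊤ (Λ (⊤ ⇒ var zero) (ƛ (var (suc zero)) top))

exTerm : Tm false 0
exTerm = poly ⟪ ⊤ ⇒ ⊤ ⟫

exType : Ty false 0
exType = ∀T (⊤ ⇒ ⊤ ⇒ ⊤) (var zero ⇒ ⊤)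

exTerm-typableK : ∅ ⊢K embTm exTerm ∶ embTy exType
exTerm-typableK =
  t-sub (t-tapp (t-sub poly-typed (s-∀loc s-refl s-refl)) s-top) (s-∀loc s-refl (s-arr Y<:⊤⇒⊤ s-refl))
  where
  poly-typed : ∅ ⊢K embTm poly ∶ ∀K ⊤ (∀K (⊤ ⇒ var zero) (var (suc zero) ⇒ ⊤))
  poly-typed = t-tabs (t-tabs (t-abs t-top))

  Y<:⊤⇒⊤ : (∅ ,<: (⊤ ⇒ ⊤ ⇒ ⊤)) ⊢K var zero <: (⊤ ⇒ ⊤)
  Y<:⊤⇒⊤ = s-trans (s-var here) (s-arr s-refl s-top)

<:X⇒≡X : ((∅ ,<: ⊤) ,<: (⊤ ⇒ var zero)) ⊢⊤ C <: var (suc zero) → C ≡ var (suc zero)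
<:X⇒≡X d with <:var⇒var d
... | suc zero , refl = refl
... | zero , refl with var<:-inv d
...   | inj₁ ()
...   | inj₂ (_ , here , ⊤⇒X<:X) with <:var⇒var ⊤⇒X<:X
...     | _ , ()

instantiated-body-≮:Y⇒⊤ : ∀ {T} → ((∅ ,<: ⊤) ,<: (⊤ ⇒ var zero)) ⊢⊤ ƛ (var (suc zero)) top ∶ T →
                          ¬ ((∅ ,<: ⊤) ⊢⊤ sub (exts (sub0 (⊤ ⇒ ⊤))) T <: (var zero ⇒ ⊤))
instantiated-body-≮:Y⇒⊤ d e with ƛ-inv d
... | inj₂ (_ , _ , refl , C<:X) with <:X⇒≡X C<:X
...   | refl with ⇒<:-inv e
...     | inj₁ ()
...     | inj₂ (_ , _ , refl , Y<:⊤⇒⊤ , _) with var₀<:-inv Y<:⊤⇒⊤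
...       | inj₁ ()
...       | inj₂ ()
instantiated-body-≮:Y⇒⊤ d e | inj₁ refl with ⊤<:⇒≡⊤ e
... | ()

exTerm-untypable : ¬ (∅ ⊢⊤ exTerm ∶ exType)
exTerm-untypable d with ⟪⟫-inv d
... | _ , _ , d-poly , inst<:exType with Λ-inv d-poly
... | inj₁ ()
... | inj₂ (_ , _ , refl , d-inner) with Λ-inv d-inner
... | inj₂ (_ , _ , refl , d-body) with ∀<:-inv inst<:exType
...   | inj₁ ()
...   | inj₂ (_ , _ , refl , body<:Y⇒⊤) = instantiated-body-≮:Y⇒⊤ d-body body<:Y⇒⊤
exTerm-untypable d | _ , _ , _ , inst<:exType | inj₂ (_ , _ , refl , _) | inj₁ refl
  with ⊤<:⇒≡⊤ inst<:exType
... | ()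

mainTheorem8 : Σ ℕ (λ n → Σ (Ctx false n) (λ Θ → Σ (Tm false n) (λ t → Σ (Ty false n) (λ T →
    (embCtx Θ ⊢K embTm t ∶ embTy T) × ¬ (Θ ⊢⊤ t ∶ T)))))
mainTheorem8 = 0 , ∅ , exTerm , exType , exTerm-typableK , exTerm-untypable
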